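{- Let $G$ be a finite simple undirected graph. The following are equivalent: (a) $G$ is a split graph; (b) $G$ is chordal and $\overline{G}$ is chordal; (c) $G$ has a vertex ordering $(v_1,\dots,v_n)$ that simultaneously satisfies: for all $i<j<k$, if $v_iv_j\in E(G)$ and $v_iv_k\in E(G)$ then $v_jv_k\in E(G)$; and for all $i<j<k$, if $v_iv_j\in E(G)$ then $v_jv_k\in E(G)$ or $v_iv_k\in E(G)$; (d) $G$ has a vertex ordering $(v_1,\dots,v_n)$ such that for all $i<j<k$, if $v_iv_j\in E(G)$ then $v_jv_k\in E(G)$.
   Context: A vertex ordering of $G$ is a total order $(v_1,\dots,v_n)$ of $V(G)$. The complement $\overline{G}$ has vertex set $V(G)$ and edge set $\{vw: v\ne w,\ vw\notin E(G)\}$. A graph is chordal if every induced cycle on at least four vertices has a chord (equivalently, has no induced cycle of length at least four). $G$ is a split graph if $V(G)=K\cup I$ where $K$ induces a complete subgraph and $I$ is an independent set. -}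

module Defs where

open import Data.Nat using (ℕ; suc; _≤_; _<_)
open import Data.Fin using (Fin; toℕ)
open import Data.Bool using (Bool; true; false)
open import Data.Product using (_×_; Σ; ∃)
open import Data.Sum using (_⊎_)
open import Data.Empty using (⊥)
open import Relation.Nullary using (¬_; Dec)
open import Relation.Binary.PropositionalEquality using (_≡_)
open import Function.Bundles using (_↔_; _⇔_)
open import Function.Definitions using (Injective)
open import Level using (0ℓ)

record Graph (n : ℕ) : Set₁ where
  field
    Adj   : Fin n → Fin n → Set
    dec   : ∀ u v → Dec (Adj u v)
    sym   : ∀ {u v} → Adj u v → Adj v u
    irref : ∀ {u} → ¬ Adj u u
open Graph public

complement : ∀ {n} → Graph n → Graph n
complement {n} G = record
  { Adj   = λ u v → ¬ (u ≡ v) × ¬ Adj G u v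
  ; dec   = dec'
  ; sym   = λ { (p , q) → (λ e → p (≡sym e)) , (λ a → q (Graph.sym G a)) }
  ; irref = λ { (p , _) → p refl }
  }
  where
  open import Data.Product using (_,_)
  open import Relation.Binary.PropositionalEquality using (refl) renaming (sym to ≡sym)
  open import Relation.Nullary using (yes; no)
  open import Relation.Nullary.Decidable using (_×-dec_; ¬?)
  open import Data.Fin using (_≟_)
  dec' : ∀ u v → Dec (¬ (u ≡ v) × ¬ Adj G u v)
  dec' u v = ¬? (u ≟ v) ×-dec ¬? (Graph.dec G u v)

-- Split graph: V = K ∪ I, K a clique, I an independent set
-- (K given by a characteristic function; I is its complement).
IsSplit : ∀ {n} → Graph n → Set
IsSplit {n} G = Σ (Fin n → Bool) λ inK →
    (∀ u v → inK u ≡ true  → inK v ≡ true  → ¬ (u ≡ v) → Adj G u v)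
  × (∀ u v → inK u ≡ false → inK v ≡ false → ¬ Adj G u v)

CycNext : ∀ {k} → Fin k → Fin k → Set
CycNext {k} i j = suc (toℕ i) ≡ toℕ j ⊎ (suc (toℕ i) ≡ k × toℕ j ≡ 0)

CycAdj : ∀ {k} → Fin k → Fin k → Set
CycAdj i j = CycNext i j ⊎ CycNext j i

IsInducedCycle : ∀ {n k} → Graph n → (Fin k → Fin n) → Set
IsInducedCycle G c = Injective _≡_ _≡_ c × (∀ i j → Adj G (c i) (c j) ⇔ CycAdj i j)

IsChordal : ∀ {n} → Graph n → Set
IsChordal {n} G = ∀ (k : ℕ) → 4 ≤ k → (c : Fin k → Fin n) → ¬ IsInducedCycle G c

-- A vertex ordering: a bijection between positions (Fin n) and vertices;
-- σ position i = v_i.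
VertexOrdering : ℕ → Set
VertexOrdering n = Fin n ↔ Fin n

open import Function.Bundles using (Inverse)

CondC : ∀ {n} → Graph n → VertexOrdering n → Set
CondC {n} G σ =
  let v = Inverse.to σ in
    (∀ (i j k : Fin n) → toℕ i < toℕ j → toℕ j < toℕ k →
       Adj G (v i) (v j) → Adj G (v i) (v k) → Adj G (v j) (v k))
  × (∀ (i j k : Fin n) → toℕ i < toℕ j → toℕ j < toℕ k →
       Adj G (v i) (v j) → Adj G (v j) (v k) ⊎ Adj G (v i) (v k))

CondD : ∀ {n} → Graph n → VertexOrdering n → Set
CondD {n} G σ =
  let v = Inverse.to σ in
    ∀ (i j k : Fin n) → toℕ i < toℕ j → toℕ j < toℕ k →
       Adj G (v i) (v j) → Adj G (v j) (v k)

{-# OPTIONS --safe #-}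
-- A split graph is chordal: in an induced cycle c of length ≥ 4 every edge needs an endpoint in the
-- clique K, while K contains no two non-adjacent vertices, and these constraints already clash on
-- c (k-1), c 0, c 1, c 2, c 3. Complements of split graphs are split. Listing the independent side
-- before K gives an ordering with (d), which implies (c); conversely, for an ordering with (c) the
-- vertices having an earlier neighbour form a clique whose complement is independent.
--
-- In the hard direction, chordality of G and of its complement is only used to exclude induced C₄,
-- C₅ and 2K₂. By induction on the number of vertices, deleting a vertex s leaves a split graph, so
-- G has a clique K with s ∉ K such that every edge outside K contains s. Such a "star" is turned
-- into a split partition by absorbing s or one of its neighbours into K, or by exchanging a vertex a
-- of K against s (a becomes the new centre) or against a neighbour of s. Each move keeps the star
-- shape and strictly shrinks the set of neighbours of the centre outside K, so well-founded
-- induction on ⊂ terminates.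
module Submission where

open import Defs
open import Data.Bool using (Bool; true; false; not)
open import Data.Bool.Properties using (not-¬; not-involutive)
open import Data.Empty using (⊥; ⊥-elim)
open import Data.Fin as Fin using (Fin; zero; suc; toℕ; punchIn; punchOut)
open import Data.Fin.Patterns using (0F; 1F; 2F; 3F; 4F)
open import Data.Fin.Properties as Finₚ
  using (any?; all?; suc-injective; punchIn-punchOut; punchInᵢ≢i; punchIn-cancel-≤)
open import Data.Fin.Permutation as Perm using (Permutation; _⟨$⟩ʳ_; _⟨$⟩ˡ_; inverseʳ; insert-punchIn)
open import Data.Fin.Subset using (Subset; _∈_; _∉_; _⊆_; _⊂_; _∪_; _∩_; ∁; ⁅_⁆; _-_; _─_; inside; outside)
open import Data.Fin.Subset.Properties
  using ( _∈?_; x∈⁅x⁆; x∈⁅y⁆⇒x≡y; x∈p∪q⁺; x∈p∪q⁻; x∈p∩q⁺; x∈p∩q⁻; x∉p⇒x∈∁p; x∈∁p⇒x∉p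
        ; p─q⊆p; x∈p∧x≢y⇒x∈p-y)
open import Data.Fin.Subset.Induction using (⊂-wellFounded)
open import Data.Nat as ℕ using (ℕ; _<_)
import Data.Nat.Properties as ℕₚ
open import Data.Product using (_×_; _,_; proj₁; proj₂; ∃; ∃₂)
open import Data.Sum using (_⊎_; inj₁; inj₂; [_,_]′)
open import Data.Vec using ([]; _∷_; lookup; tabulate; here; there)
open import Data.Vec.Properties using (lookup⇒[]=; []=⇒lookup; lookup∘tabulate)
open import Function using (_∘_; id)
open import Function.Bundles using (_⇔_; mk⇔; Equivalence; Injection)
open import Function.Definitions using (Injective)
import Function.Properties.Equivalence as ⇔
open import Function.Properties.Inverse using (↔⇒↣; ↔-sym)
open import Induction.WellFounded using (Acc; acc)
open import Relation.Binary using (tri<; tri≈; tri>)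
open import Relation.Binary.PropositionalEquality as ≡ using (_≡_; _≢_; refl; cong)
open import Relation.Nullary using (¬_; Dec; yes; no; does)
open import Relation.Nullary.Decidable
  using (_×-dec_; _⊎-dec_; _→-dec_; ¬?; dec-true; dec-yes; decidable-stable)
open import Relation.Unary using (Pred; Decidable)

private variable
  k m n : ℕ

module Notation {n} (G : Graph n) where
  infix 4 _~_ _≁_
  _~_ _≁_ : Fin n → Fin n → Set
  _~_ = Adj G
  _≁_ = Adj (complement G)

  ~⇒≢ : ∀ {u v} → u ~ v → u ≢ v
  ~⇒≢ u~v refl = irref G u~v

  ≁-sym : ∀ {u v} → u ≁ v → v ≁ u
  ≁-sym = sym (complement G)

  ~×¬~⇒≢ : ∀ {u v w} → u ~ v → ¬ u ~ w → v ≢ w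
  ~×¬~⇒≢ u~v ¬u~w refl = ¬u~w u~v

cycAdj? : (i j : Fin k) → Dec (CycAdj i j)
cycAdj? {k} i j = next? i j ⊎-dec next? j i
  where
  next? : (i j : Fin k) → Dec (CycNext i j)
  next? i j = (ℕ.suc (toℕ i) ℕ.≟ toℕ j) ⊎-dec ((ℕ.suc (toℕ i) ℕ.≟ k) ×-dec (toℕ j ℕ.≟ 0))

module InducedCycles {n} (G : Graph n) where
  open Notation G

  private variable
    a b c d e : Fin n

  CycleEntry : (cycle : Fin k → Fin n) (i j : Fin k) → Dec (CycAdj i j) → Set
  CycleEntry cycle i j (yes _) = cycle i ~ cycle j
  CycleEntry cycle i j (no _)  = i ≡ j ⊎ cycle i ≁ cycle j

  inducedCycle : (cycle : Fin k → Fin n) → (∀ i j → CycleEntry cycle i j (cycAdj? i j)) →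
                 IsInducedCycle G cycle
  inducedCycle cycle entry = injective , λ i j → mk⇔ (adj⇒cycAdj i j) (cycAdj⇒adj i j)
    where
    injective : Injective _≡_ _≡_ cycle
    injective {i} {j} ci≡cj with cycAdj? i j | entry i j
    ... | yes _ | ci~cj      = ⊥-elim (~⇒≢ ci~cj ci≡cj)
    ... | no _  | inj₁ i≡j   = i≡j
    ... | no _  | inj₂ ci≁cj = ⊥-elim (proj₁ ci≁cj ci≡cj)
    adj⇒cycAdj : ∀ i j → cycle i ~ cycle j → CycAdj i j
    adj⇒cycAdj i j ci~cj with cycAdj? i j | entry i j
    ... | yes i-j | _          = i-j
    ... | no _    | inj₁ refl  = ⊥-elim (irref G ci~cj)
    ... | no _    | inj₂ ci≁cj = ⊥-elim (proj₂ ci≁cj ci~cj)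
    cycAdj⇒adj : ∀ i j → CycAdj i j → cycle i ~ cycle j
    cycAdj⇒adj i j i-j with cycAdj? i j | entry i j
    ... | yes _  | ci~cj = ci~cj
    ... | no ¬ij | _     = ⊥-elim (¬ij i-j)

  cycle-edge : ∀ {cycle : Fin k → Fin n} {i j} → IsInducedCycle G cycle →
               CycAdj i j → cycle i ~ cycle j
  cycle-edge (_ , induced) = Equivalence.from (induced _ _)

  cycle-non-edge : ∀ {cycle : Fin k → Fin n} {i j} → IsInducedCycle G cycle →
                   i ≢ j → ¬ CycAdj i j → cycle i ≁ cycle j
  cycle-non-edge (injective , induced) i≢j ¬ij = i≢j ∘ injective , ¬ij ∘ Equivalence.to (induced _ _)

  chordal⇒noC₄ : IsChordal G → a ~ b → b ~ c → c ~ d → d ~ a → a ≁ c → b ≁ d → ⊥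
  chordal⇒noC₄ {a} {b} {c} {d} chordal ab bc cd da ac bd =
    chordal 4 ℕₚ.≤-refl cycle (inducedCycle cycle entry)
    where
    cycle : Fin 4 → Fin n
    cycle = lookup (a ∷ b ∷ c ∷ d ∷ [])
    entry : ∀ i j → CycleEntry cycle i j (cycAdj? i j)
    entry 0F 0F = inj₁ refl       ; entry 0F 1F = ab              ; entry 0F 2F = inj₂ ac
    entry 0F 3F = sym G da
    entry 1F 0F = sym G ab        ; entry 1F 1F = inj₁ refl       ; entry 1F 2F = bc
    entry 1F 3F = inj₂ bd
    entry 2F 0F = inj₂ (≁-sym ac) ; entry 2F 1F = sym G bc        ; entry 2F 2F = inj₁ refl
    entry 2F 3F = cd
    entry 3F 0F = da              ; entry 3F 1F = inj₂ (≁-sym bd) ; entry 3F 2F = sym G cd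
    entry 3F 3F = inj₁ refl

  chordal⇒noC₅ : IsChordal G → a ~ b → b ~ c → c ~ d → d ~ e → e ~ a →
                 a ≁ c → a ≁ d → b ≁ d → b ≁ e → c ≁ e → ⊥
  chordal⇒noC₅ {a} {b} {c} {d} {e} chordal ab bc cd de ea ac ad bd be ce =
    chordal 5 (ℕₚ.n≤1+n 4) cycle (inducedCycle cycle entry)
    where
    cycle : Fin 5 → Fin n
    cycle = lookup (a ∷ b ∷ c ∷ d ∷ e ∷ [])
    entry : ∀ i j → CycleEntry cycle i j (cycAdj? i j)
    entry 0F 0F = inj₁ refl       ; entry 0F 1F = ab              ; entry 0F 2F = inj₂ ac
    entry 0F 3F = inj₂ ad         ; entry 0F 4F = sym G ea
    entry 1F 0F = sym G ab        ; entry 1F 1F = inj₁ refl       ; entry 1F 2F = bc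
    entry 1F 3F = inj₂ bd         ; entry 1F 4F = inj₂ be
    entry 2F 0F = inj₂ (≁-sym ac) ; entry 2F 1F = sym G bc        ; entry 2F 2F = inj₁ refl
    entry 2F 3F = cd              ; entry 2F 4F = inj₂ ce
    entry 3F 0F = inj₂ (≁-sym ad) ; entry 3F 1F = inj₂ (≁-sym bd) ; entry 3F 2F = sym G cd
    entry 3F 3F = inj₁ refl       ; entry 3F 4F = de
    entry 4F 0F = ea              ; entry 4F 1F = inj₂ (≁-sym be) ; entry 4F 2F = inj₂ (≁-sym ce)
    entry 4F 3F = sym G de        ; entry 4F 4F = inj₁ refl

module _ {n} (G : Graph n) where
  open Notation G

  cochordal⇒no2K₂ : IsChordal (complement G) →
                    ∀ {a b c d} → a ~ b → c ~ d → a ≁ c → a ≁ d → b ≁ c → b ≁ d → ⊥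
  cochordal⇒no2K₂ cochordal ab cd ac ad bc bd =
    InducedCycles.chordal⇒noC₄ (complement G) cochordal ac (≁-sym bc) bd (≁-sym ad) (edge ab) (edge cd)
    where
    edge : ∀ {u v} → u ~ v → Adj (complement (complement G)) u v
    edge u~v = ~⇒≢ u~v , λ u≁v → proj₂ u≁v u~v

restrict : Graph n → (Fin m → Fin n) → Graph m
restrict G f = record
  { Adj   = λ u v → Adj G (f u) (f v)
  ; dec   = λ u v → dec G (f u) (f v)
  ; sym   = sym G
  ; irref = irref G
  }

chordal-reflect : ∀ (G : Graph n) (H : Graph m) (f : Fin m → Fin n) → Injective _≡_ _≡_ f →
                  (∀ u v → Adj H u v ⇔ Adj G (f u) (f v)) → IsChordal G → IsChordal H
chordal-reflect G H f f-injective H⇔G chordal k k≥4 cycle (injective , induced) =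
  chordal k k≥4 (f ∘ cycle)
    (injective ∘ f-injective , λ i j → ⇔.trans (⇔.sym (H⇔G (cycle i) (cycle j))) (induced i j))

restrict-chordal : ∀ (G : Graph n) {f : Fin m → Fin n} → Injective _≡_ _≡_ f →
                   IsChordal G → IsChordal (restrict G f)
restrict-chordal G {f} f-injective = chordal-reflect G (restrict G f) f f-injective λ _ _ → ⇔.refl

restrict-cochordal : ∀ (G : Graph n) {f : Fin m → Fin n} → Injective _≡_ _≡_ f →
                     IsChordal (complement G) → IsChordal (complement (restrict G f))
restrict-cochordal G {f} f-injective =
  chordal-reflect (complement G) (complement (restrict G f)) f f-injective λ _ _ →
    mk⇔ (λ (u≢v , ¬uv) → u≢v ∘ f-injective , ¬uv) (λ (fu≢fv , ¬uv) → fu≢fv ∘ cong f , ¬uv)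

toSubset : ∀ {ℓ} {P : Pred (Fin n) ℓ} → Decidable P → Subset n
toSubset P? = tabulate (does ∘ P?)

module _ {ℓ} {P : Pred (Fin n) ℓ} (P? : Decidable P) where

  ∈-toSubset⁺ : ∀ {x} → P x → x ∈ toSubset P?
  ∈-toSubset⁺ {x} px = lookup⇒[]= x _ (≡.trans (lookup∘tabulate _ x) (dec-true (P? x) px))

  ∈-toSubset⁻ : ∀ {x} → x ∈ toSubset P? → P x
  ∈-toSubset⁻ {x} x∈ with P? x | ≡.trans (≡.sym (lookup∘tabulate _ x)) ([]=⇒lookup x∈)
  ... | yes px | _  = px
  ... | no _   | ()

y∈p∪⁅y⁆ : ∀ (p : Subset n) y → y ∈ p ∪ ⁅ y ⁆
y∈p∪⁅y⁆ p y = x∈p∪q⁺ (inj₂ (x∈⁅x⁆ y))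

x∈p∪⁅y⁆⁻ : ∀ {p : Subset n} {x y} → x ∈ p ∪ ⁅ y ⁆ → x ∈ p ⊎ x ≡ y
x∈p∪⁅y⁆⁻ {p = p} {y = y} x∈ with x∈p∪q⁻ p ⁅ y ⁆ x∈
... | inj₁ x∈p = inj₁ x∈p
... | inj₂ x∈y = inj₂ (x∈⁅y⁆⇒x≡y y x∈y)

x∉p∪⁅y⁆⁻ : ∀ {p : Subset n} {x y} → x ∉ p ∪ ⁅ y ⁆ → x ∉ p × x ≢ y
x∉p∪⁅y⁆⁻ {p = p} x∉ = (λ x∈p → x∉ (x∈p∪q⁺ (inj₁ x∈p))) , λ { refl → x∉ (y∈p∪⁅y⁆ p _) }

x∈q⇒x∉p─q : ∀ (p q : Subset n) {x} → x ∈ q → x ∉ p ─ q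
x∈q⇒x∉p─q (_ ∷ p) (inside ∷ q) here ()
x∈q⇒x∉p─q (_ ∷ p) (_ ∷ q) (there x∈q) (there x∈p─q) = x∈q⇒x∉p─q p q x∈q x∈p─q

x∈p-y⇒x∈p∧x≢y : ∀ {p : Subset n} {x y} → x ∈ p - y → x ∈ p × x ≢ y
x∈p-y⇒x∈p∧x≢y {p = p} {y = y} x∈ = p─q⊆p p ⁅ y ⁆ x∈ , λ { refl → x∈q⇒x∉p─q p ⁅ y ⁆ (x∈⁅x⁆ y) x∈ }

module Partitions {n} (G : Graph n) where
  open Notation G

  private variable
    u v z : Fin n
    K K′ : Subset n

  Clique : Subset n → Set
  Clique K = ∀ {u v} → u ∈ K → v ∈ K → u ≢ v → u ~ v

  SplitPartition : Subset n → Set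
  SplitPartition K = Clique K × (∀ {u v} → u ∉ K → v ∉ K → ¬ u ~ v)

  CompleteTo : Fin n → Subset n → Set
  CompleteTo v K = ∀ {c} → c ∈ K → v ~ c

  complete? : ∀ v K → Dec (CompleteTo v K)
  complete? v K with all? (λ c → c ∈? K →-dec dec G v c)
  ... | yes complete = yes (complete _)
  ... | no ¬complete = no λ complete → ¬complete λ c → complete

  non-neighbour : ¬ CompleteTo v K → ∃ λ c → c ∈ K × ¬ v ~ c
  non-neighbour {v} {K} ¬complete with any? (λ c → c ∈? K ×-dec ¬? (dec G v c))
  ... | yes found = found
  ... | no none   = ⊥-elim (¬complete λ {c} c∈K →
                      decidable-stable (dec G v c) λ ¬v~c → none (c , c∈K , ¬v~c))

  ∉∈⇒≢ : u ∉ K → v ∈ K → u ≢ v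
  ∉∈⇒≢ u∉K v∈K refl = u∉K v∈K

  non-edge : u ∉ K → v ∈ K → ¬ u ~ v → u ≁ v
  non-edge u∉K v∈K ¬u~v = ∉∈⇒≢ u∉K v∈K , ¬u~v

  clique-⊆ : K′ ⊆ K → Clique K → Clique K′
  clique-⊆ K′⊆K clique u∈ v∈ = clique (K′⊆K u∈) (K′⊆K v∈)

  clique-∪⁅⁆ : Clique K → CompleteTo z K → Clique (K ∪ ⁅ z ⁆)
  clique-∪⁅⁆ clique z⊸K u∈ v∈ u≢v with x∈p∪⁅y⁆⁻ u∈ | x∈p∪⁅y⁆⁻ v∈
  ... | inj₁ u∈K  | inj₁ v∈K  = clique u∈K v∈K u≢v
  ... | inj₁ u∈K  | inj₂ refl = sym G (z⊸K u∈K)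
  ... | inj₂ refl | inj₁ v∈K  = z⊸K v∈K
  ... | inj₂ refl | inj₂ refl = ⊥-elim (u≢v refl)

  splitPartition⇒split : SplitPartition K → IsSplit G
  splitPartition⇒split {K} (clique , independent) =
      lookup K
    , (λ u v u∈ v∈ → clique (lookup⇒[]= u K u∈) (lookup⇒[]= v K v∈))
    , (λ u v u∉ v∉ → independent (∉ u∉) (∉ v∉))
    where
    ∉ : ∀ {u} → lookup K u ≡ false → u ∉ K
    ∉ u∉ u∈ with ≡.trans (≡.sym ([]=⇒lookup u∈)) u∉
    ... | ()

module StarArgument {n} (G : Graph n) (chordal : IsChordal G) (cochordal : IsChordal (complement G)) where
  open Notation G
  open Partitions G
  open InducedCycles G using (chordal⇒noC₄; chordal⇒noC₅)

  private variable
    a b c d e u v x z : Fin n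
    K : Subset n

  noC₄ : a ~ b → b ~ c → c ~ d → d ~ a → a ≁ c → b ≁ d → ⊥
  noC₄ = chordal⇒noC₄ chordal

  noC₅ : a ~ b → b ~ c → c ~ d → d ~ e → e ~ a → a ≁ c → a ≁ d → b ≁ d → b ≁ e → c ≁ e → ⊥
  noC₅ = chordal⇒noC₅ chordal

  no2K₂ : a ~ b → c ~ d → a ≁ c → a ≁ d → b ≁ c → b ≁ d → ⊥
  no2K₂ = cochordal⇒no2K₂ G cochordal

  outerNeighbours : Subset n → Fin n → Subset n
  outerNeighbours K s = toSubset (dec G s) ∩ ∁ K

  ∈-outerNeighbours⁺ : ∀ {s} → s ~ u → u ∉ K → u ∈ outerNeighbours K s
  ∈-outerNeighbours⁺ {s = s} s~u u∉K = x∈p∩q⁺ (∈-toSubset⁺ (dec G s) s~u , x∉p⇒x∈∁p u∉K)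

  ∈-outerNeighbours⁻ : ∀ {s} → u ∈ outerNeighbours K s → s ~ u × u ∉ K
  ∈-outerNeighbours⁻ {K = K} {s} u∈ with x∈p∩q⁻ (toSubset (dec G s)) (∁ K) u∈
  ... | s~u , u∉K = ∈-toSubset⁻ (dec G s) s~u , x∈∁p⇒x∉p u∉K

  outerNeighbours-⊂ : ∀ {K′ s s′} → (∀ {u} → s′ ~ u → u ∉ K′ → s ~ u × u ∉ K) →
                      s ~ x → x ∉ K → (s′ ~ x → x ∉ K′ → ⊥) →
                      outerNeighbours K′ s′ ⊂ outerNeighbours K s
  outerNeighbours-⊂ shrinks s~x x∉K x-gone =
      (λ u∈ → let s′~u , u∉K′ = ∈-outerNeighbours⁻ u∈ ; s~u , u∉K = shrinks s′~u u∉K′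
              in ∈-outerNeighbours⁺ s~u u∉K)
    , _ , ∈-outerNeighbours⁺ s~x x∉K , λ x∈ → let s′~x , x∉K′ = ∈-outerNeighbours⁻ x∈ in x-gone s′~x x∉K′

  Star : Subset n → Fin n → Set
  Star K s = s ∉ K × (∀ {u v} → u ∉ K → v ∉ K → u ~ v → u ≡ s ⊎ v ≡ s)

  Improvement : Subset n → Fin n → Set
  Improvement K s = ∃₂ λ K′ s′ → Clique K′ × Star K′ s′ × outerNeighbours K′ s′ ⊂ outerNeighbours K s

  module Step {K s} (clique : Clique K) (s∉K : s ∉ K)
              (through-s : ∀ {u v} → u ∉ K → v ∉ K → u ~ v → u ≡ s ⊎ v ≡ s) where

    outside-non-adjacent : u ∉ K → v ∉ K → u ≢ s → v ≢ s → ¬ u ~ v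
    outside-non-adjacent u∉K v∉K u≢s v≢s u~v = [ u≢s , v≢s ]′ (through-s u∉K v∉K u~v)

    absorb-centre : CompleteTo s K → SplitPartition (K ∪ ⁅ s ⁆)
    absorb-centre s⊸K = clique-∪⁅⁆ clique s⊸K , λ u∉ v∉ →
      let u∉K , u≢s = x∉p∪⁅y⁆⁻ u∉ ; v∉K , v≢s = x∉p∪⁅y⁆⁻ v∉ in outside-non-adjacent u∉K v∉K u≢s v≢s

    absorb-neighbour : z ∉ K → s ~ z → CompleteTo z K → Improvement K s
    absorb-neighbour {z} z∉K s~z z⊸K =
        K ∪ ⁅ z ⁆ , s , clique-∪⁅⁆ clique z⊸K
      , ( (λ s∈ → [ s∉K , ~⇒≢ s~z ]′ (x∈p∪⁅y⁆⁻ s∈))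
        , λ u∉ v∉ → through-s (proj₁ (x∉p∪⁅y⁆⁻ u∉)) (proj₁ (x∉p∪⁅y⁆⁻ v∉)))
      , outerNeighbours-⊂ (λ s~u u∉ → s~u , proj₁ (x∉p∪⁅y⁆⁻ u∉)) s~z z∉K (λ _ z∉ → z∉ (y∈p∪⁅y⁆ K z))

    isolated-centre : (∀ {x} → x ∉ K → ¬ s ~ x) → SplitPartition K
    isolated-centre isolated = clique , λ u∉K v∉K u~v →
      [ (λ { refl → isolated v∉K u~v }) , (λ { refl → isolated u∉K (sym G u~v) }) ]′ (through-s u∉K v∉K u~v)

    common-non-neighbour : x ∉ K → s ~ x → ¬ CompleteTo x K → ¬ CompleteTo s K →
                           ∃ λ a → a ∈ K × s ≁ a × x ≁ a
    common-non-neighbour {x} x∉K s~x ¬x⊸K ¬s⊸K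
      with (aₓ , aₓ∈K , ¬x~aₓ) ← non-neighbour ¬x⊸K
      with (aₛ , aₛ∈K , ¬s~aₛ) ← non-neighbour ¬s⊸K
      with dec G s aₓ | dec G x aₛ
    ... | no ¬s~aₓ | _        = aₓ , aₓ∈K , non-edge s∉K aₓ∈K ¬s~aₓ , non-edge x∉K aₓ∈K ¬x~aₓ
    ... | yes _    | no ¬x~aₛ = aₛ , aₛ∈K , non-edge s∉K aₛ∈K ¬s~aₛ , non-edge x∉K aₛ∈K ¬x~aₛ
    ... | yes s~aₓ | yes x~aₛ = ⊥-elim (noC₄ (sym G s~x) s~aₓ (clique aₓ∈K aₛ∈K (~×¬~⇒≢ s~aₓ ¬s~aₛ))
                                  (sym G x~aₛ) (non-edge x∉K aₓ∈K ¬x~aₓ) (non-edge s∉K aₛ∈K ¬s~aₛ))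

    module Exchange {x a} (x∉K : x ∉ K) (s~x : s ~ x) (a∈K : a ∈ K) (s≁a : s ≁ a) (x≁a : x ≁ a)
                    (neighbours-miss : ∀ {z} → z ∉ K → s ~ z → ¬ CompleteTo z K) where

      x≢s : x ≢ s
      x≢s = ~⇒≢ (sym G s~x)

      ∉-exchange : ∀ {y u} → u ∉ (K - a) ∪ ⁅ y ⁆ → u ≢ y × (u ≡ a ⊎ u ∉ K)
      ∉-exchange {u = u} u∉ with x∉p∪⁅y⁆⁻ u∉ | u Fin.≟ a
      ... | _     , u≢y | yes u≡a = u≢y , inj₁ u≡a
      ... | u∉K-a , u≢y | no u≢a  = u≢y , inj₂ λ u∈K → u∉K-a (x∈p∧x≢y⇒x∈p-y u∈K u≢a)

      clique-exchange : ∀ {y} → CompleteTo y (K - a) → Clique ((K - a) ∪ ⁅ y ⁆)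
      clique-exchange = clique-∪⁅⁆ (clique-⊆ (p─q⊆p K ⁅ a ⁆) clique)

      outside-≁-x : u ∉ K → u ≢ x → u ≢ s → u ≁ x
      outside-≁-x u∉K u≢x u≢s = u≢x , outside-non-adjacent u∉K x∉K u≢s x≢s

      exchange-x : CompleteTo x (K - a) → Improvement K s
      exchange-x x⊸ =
          (K - a) ∪ ⁅ x ⁆ , s , clique-exchange x⊸ , (s∉ , through-s′)
        , outerNeighbours-⊂ shrinks s~x x∉K (λ _ x∉ → x∉ (y∈p∪⁅y⁆ (K - a) x))
        where
        s∉ : s ∉ (K - a) ∪ ⁅ x ⁆
        s∉ s∈ = [ s∉K ∘ p─q⊆p K ⁅ a ⁆ , ~⇒≢ s~x ]′ (x∈p∪⁅y⁆⁻ s∈)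
        a-isolated : v ∉ K → v ≢ x → ¬ a ~ v
        a-isolated {v} v∉K v≢x a~v with v Fin.≟ s | dec G s v
        ... | yes refl | _       = proj₂ s≁a (sym G a~v)
        ... | no v≢s   | no ¬s~v = no2K₂ a~v (sym G s~x) (≁-sym x≁a) (≁-sym s≁a)
                                     (outside-≁-x v∉K v≢x v≢s) (v≢s , ¬s~v ∘ sym G)
        ... | no v≢s   | yes s~v
          with (c , c∈K , ¬v~c) ← non-neighbour (neighbours-miss v∉K s~v)
          with c≢a ← ≡.≢-sym (~×¬~⇒≢ (sym G a~v) ¬v~c)
          with dec G s c
        ...   | yes s~c = noC₄ (sym G s~v) s~c (clique c∈K a∈K c≢a) a~v (non-edge v∉K c∈K ¬v~c) s≁a
        ...   | no ¬s~c = noC₅ (sym G s~v) s~x (x⊸ (x∈p∧x≢y⇒x∈p-y c∈K c≢a)) (clique c∈K a∈K c≢a) a~v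
                            (outside-≁-x v∉K v≢x v≢s) (non-edge v∉K c∈K ¬v~c) (non-edge s∉K c∈K ¬s~c)
                            s≁a x≁a
        through-s′ : u ∉ (K - a) ∪ ⁅ x ⁆ → v ∉ (K - a) ∪ ⁅ x ⁆ → u ~ v → u ≡ s ⊎ v ≡ s
        through-s′ u∉ v∉ u~v with ∉-exchange u∉ | ∉-exchange v∉
        ... | _   , inj₁ refl | _   , inj₁ refl = ⊥-elim (irref G u~v)
        ... | _   , inj₁ refl | v≢x , inj₂ v∉K  = ⊥-elim (a-isolated v∉K v≢x u~v)
        ... | u≢x , inj₂ u∉K  | _   , inj₁ refl = ⊥-elim (a-isolated u∉K u≢x (sym G u~v))
        ... | _   , inj₂ u∉K  | _   , inj₂ v∉K  = through-s u∉K v∉K u~v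
        shrinks : s ~ u → u ∉ (K - a) ∪ ⁅ x ⁆ → s ~ u × u ∉ K
        shrinks s~u u∉ with ∉-exchange u∉
        ... | _ , inj₁ refl = ⊥-elim (proj₂ s≁a s~u)
        ... | _ , inj₂ u∉K  = s~u , u∉K

      exchange-s : CompleteTo s (K - a) → Improvement K s
      exchange-s s⊸ =
          (K - a) ∪ ⁅ s ⁆ , a , clique-exchange s⊸ , (a∉ , through-a)
        , outerNeighbours-⊂ shrinks s~x x∉K (λ a~x _ → proj₂ x≁a (sym G a~x))
        where
        a∉ : a ∉ (K - a) ∪ ⁅ s ⁆
        a∉ a∈ = [ x∈q⇒x∉p─q K ⁅ a ⁆ (x∈⁅x⁆ a) , proj₁ (≁-sym s≁a) ]′ (x∈p∪⁅y⁆⁻ a∈)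
        through-a : u ∉ (K - a) ∪ ⁅ s ⁆ → v ∉ (K - a) ∪ ⁅ s ⁆ → u ~ v → u ≡ a ⊎ v ≡ a
        through-a u∉ v∉ u~v with ∉-exchange u∉ | ∉-exchange v∉
        ... | _   , inj₁ u≡a | _              = inj₁ u≡a
        ... | _   , inj₂ _   | _   , inj₁ v≡a = inj₂ v≡a
        ... | u≢s , inj₂ u∉K | v≢s , inj₂ v∉K = ⊥-elim (outside-non-adjacent u∉K v∉K u≢s v≢s u~v)
        shrinks : a ~ u → u ∉ (K - a) ∪ ⁅ s ⁆ → s ~ u × u ∉ K
        shrinks {u} a~u u∉ with ∉-exchange u∉
        ... | _   , inj₁ refl = ⊥-elim (irref G a~u)
        ... | u≢s , inj₂ u∉K  = decidable-stable (dec G s u) ¬¬s~u , u∉K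
          where
          ¬¬s~u : ¬ ¬ s ~ u
          ¬¬s~u ¬s~u = no2K₂ a~u (sym G s~x) (≁-sym x≁a) (≁-sym s≁a)
                         (outside-≁-x u∉K (~×¬~⇒≢ a~u (proj₂ (≁-sym x≁a))) u≢s) (u≢s , ¬s~u ∘ sym G)

      no-third-option : ¬ CompleteTo x (K - a) → ¬ CompleteTo s (K - a) → ⊥
      no-third-option ¬x⊸ ¬s⊸
        with (b , b∈ , ¬x~b) ← non-neighbour ¬x⊸
        with (c , c∈ , ¬s~c) ← non-neighbour ¬s⊸
        with (b∈K , b≢a) ← x∈p-y⇒x∈p∧x≢y b∈
        with (c∈K , c≢a) ← x∈p-y⇒x∈p∧x≢y c∈
        with dec G s b | dec G x c
      ... | no ¬s~b | _       = no2K₂ (sym G s~x) (clique a∈K b∈K (≡.≢-sym b≢a)) x≁a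
                                  (non-edge x∉K b∈K ¬x~b) s≁a (non-edge s∉K b∈K ¬s~b)
      ... | yes _   | no ¬x~c = no2K₂ (sym G s~x) (clique a∈K c∈K (≡.≢-sym c≢a)) x≁a
                                  (non-edge x∉K c∈K ¬x~c) s≁a (non-edge s∉K c∈K ¬s~c)
      ... | yes s~b | yes x~c = noC₄ (sym G s~x) s~b (clique b∈K c∈K (~×¬~⇒≢ s~b ¬s~c)) (sym G x~c)
                                  (non-edge x∉K b∈K ¬x~b) (non-edge s∉K c∈K ¬s~c)

      improvement : Improvement K s
      improvement with complete? x (K - a) | complete? s (K - a)
      ... | yes x⊸ | _      = exchange-x x⊸
      ... | no _   | yes s⊸ = exchange-s s⊸
      ... | no ¬x⊸ | no ¬s⊸ = ⊥-elim (no-third-option ¬x⊸ ¬s⊸)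

    exchange : x ∉ K → s ~ x → (∀ {z} → z ∉ K → s ~ z → ¬ CompleteTo z K) → ¬ CompleteTo s K →
               Improvement K s
    exchange x∉K s~x neighbours-miss ¬s⊸K
      with (a , a∈K , s≁a , x≁a) ← common-non-neighbour x∉K s~x (neighbours-miss x∉K s~x) ¬s⊸K
      = Exchange.improvement x∉K s~x a∈K s≁a x≁a neighbours-miss

    step : ∃ SplitPartition ⊎ Improvement K s
    step with complete? s K
    ... | yes s⊸K = inj₁ (_ , absorb-centre s⊸K)
    ... | no ¬s⊸K with any? (λ z → ¬? (z ∈? K) ×-dec dec G s z ×-dec complete? z K)
    ...   | yes (z , z∉K , s~z , z⊸K) = inj₂ (absorb-neighbour z∉K s~z z⊸K)
    ...   | no none with any? (λ x → ¬? (x ∈? K) ×-dec dec G s x)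
    ...     | no isolated = inj₁ (K , isolated-centre λ x∉K s~x → isolated (_ , x∉K , s~x))
    ...     | yes (x , x∉K , s~x) =
      inj₂ (exchange x∉K s~x (λ z∉K s~z z⊸K → none (_ , z∉K , s~z , z⊸K)) ¬s⊸K)

  star⇒splitPartition : ∀ {K s} → Acc _⊂_ (outerNeighbours K s) → Clique K → Star K s → ∃ SplitPartition
  star⇒splitPartition (acc rec) clique (s∉K , through-s) with Step.step clique s∉K through-s
  ... | inj₁ partition = partition
  ... | inj₂ (_ , _ , clique′ , star′ , shrinks) = star⇒splitPartition (rec shrinks) clique′ star′

chordal⇒splitPartition : ∀ {n} (G : Graph n) → IsChordal G → IsChordal (complement G) →
                         ∃ (Partitions.SplitPartition G)
chordal⇒splitPartition {ℕ.zero} G _ _ = [] , (λ ()) , λ { {()} }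
chordal⇒splitPartition {ℕ.suc n} G chordal cochordal
  with (K , clique , independent) ← chordal⇒splitPartition (restrict G suc)
         (restrict-chordal G suc-injective chordal) (restrict-cochordal G suc-injective cochordal)
  = star⇒splitPartition (⊂-wellFounded _) clique′ ((λ ()) , through-zero)
  where
  open Notation G
  open StarArgument G chordal cochordal
  clique′ : Partitions.Clique G (outside ∷ K)
  clique′ (there u∈K) (there v∈K) u≢v = clique u∈K v∈K (u≢v ∘ cong suc)
  through-zero : ∀ {u v} → u ∉ outside ∷ K → v ∉ outside ∷ K → u ~ v → u ≡ zero ⊎ v ≡ zero
  through-zero {zero}               _  _  _   = inj₁ refl
  through-zero {suc _} {zero}       _  _  _   = inj₂ refl
  through-zero {suc _} {suc _}      u∉ v∉ u~v = ⊥-elim (independent (u∉ ∘ there) (v∉ ∘ there) u~v)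

module SplitGraph {n} (G : Graph n) (split : IsSplit G) where
  open Notation G
  open InducedCycles G using (cycle-edge; cycle-non-edge)

  inK : Fin n → Bool
  inK = proj₁ split

  other-end : ∀ {u v} → u ~ v → inK u ≡ false → inK v ≡ true
  other-end {u} {v} u~v u∉K with inK v in v∈K?
  ... | true  = refl
  ... | false = ⊥-elim (proj₂ (proj₂ split) u v u∉K v∈K? u~v)

  not-both : ∀ {u v} → u ≁ v → inK u ≡ true → inK v ≡ false
  not-both {u} {v} (u≢v , ¬u~v) u∈K with inK v in v∈K?
  ... | false = refl
  ... | true  = ⊥-elim (¬u~v (proj₁ (proj₂ split) u v u∈K v∈K? u≢v))

  split-obstruction : ∀ {a b c d e} → a ~ b → b ~ c → c ~ d → e ~ a → a ≁ c → b ≁ d → b ≁ e → ⊥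
  split-obstruction {b = b} ab bc cd ea ac bd be with inK b in b∈K?
  ... | false = not-¬ (other-end bc b∈K?) (not-both ac (other-end (sym G ab) b∈K?))
  ... | true  = not-¬ (other-end (sym G ea) a∉K) (not-both be b∈K?)
    where
    a∉K = not-both (≁-sym ac) (other-end (sym G cd) (not-both bd b∈K?))

  split⇒chordal : IsChordal G
  split⇒chordal _ (ℕ.s≤s (ℕ.s≤s (ℕ.s≤s (ℕ.s≤s {n = k} _)))) cycle induced =
    split-obstruction (next refl) (next refl) (next refl) last-0
      (cycle-non-edge induced (λ ()) ¬0-2) (cycle-non-edge induced (λ ()) ¬1-3)
      (cycle-non-edge induced (λ ()) ¬1-last)
    where
    last = Fin.fromℕ (3 ℕ.+ k)
    next : ∀ {i j} → ℕ.suc (toℕ i) ≡ toℕ j → cycle i ~ cycle j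
    next i→j = cycle-edge induced (inj₁ (inj₁ i→j))
    last-0 : cycle last ~ cycle 0F
    last-0 = cycle-edge induced (inj₁ (inj₂ (cong ℕ.suc (Finₚ.toℕ-fromℕ (3 ℕ.+ k)) , refl)))
    ¬0-2 : ¬ CycAdj 0F 2F
    ¬0-2 = λ { (inj₁ (inj₁ ())) ; (inj₁ (inj₂ (() , _))) ; (inj₂ (inj₁ ())) ; (inj₂ (inj₂ (() , _))) }
    ¬1-3 : ¬ CycAdj 1F 3F
    ¬1-3 = λ { (inj₁ (inj₁ ())) ; (inj₁ (inj₂ (() , _))) ; (inj₂ (inj₁ ())) ; (inj₂ (inj₂ (_ , ()))) }
    ¬1-last : ¬ CycAdj 1F last
    ¬1-last = λ { (inj₁ (inj₁ ())) ; (inj₁ (inj₂ (() , _))) ; (inj₂ (inj₁ ())) ; (inj₂ (inj₂ (_ , ()))) }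

split⇒complement-split : ∀ (G : Graph n) → IsSplit G → IsSplit (complement G)
split⇒complement-split G (inK , clique , independent) =
    not ∘ inK
  , (λ u v u∈ v∈ u≢v → u≢v , independent u v (not-flip u∈) (not-flip v∈))
  , (λ u v u∉ v∉ (u≢v , ¬u~v) → ¬u~v (clique u v (not-flip u∉) (not-flip v∉) u≢v))
  where
  not-flip : ∀ {b c} → not b ≡ c → b ≡ not c
  not-flip {b} nb≡c = ≡.trans (≡.sym (not-involutive b)) (cong not nb≡c)

Sorts : (Fin n → Bool) → VertexOrdering n → Set
Sorts f σ = ∀ {p q} → p Fin.≤ q → f (σ ⟨$⟩ʳ p) ≡ true → f (σ ⟨$⟩ʳ q) ≡ true

insert-at : ∀ (i : Fin (ℕ.suc m)) j (π : Permutation m n) → Perm.insert i j π ⟨$⟩ʳ i ≡ j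
insert-at i j π rewrite proj₂ (dec-yes (i Fin.≟ i) refl) = refl

punchIn-view : ∀ (i q : Fin (ℕ.suc n)) → q ≡ i ⊎ ∃ λ k → q ≡ punchIn i k
punchIn-view i q with i Fin.≟ q
... | yes refl = inj₁ refl
... | no i≢q   = inj₂ (punchOut i≢q , ≡.sym (punchIn-punchOut i≢q))

sorting : ∀ (f : Fin n → Bool) → ∃ (Sorts f)
sorting {ℕ.zero} f = Perm.id , λ { {()} }
sorting {ℕ.suc n} f with sorting (f ∘ suc) | f zero in f₀
... | π , π-sorts | false = Perm.lift₀ π , sorts
  where
  sorts : Sorts f (Perm.lift₀ π)
  sorts {zero}          _           f₀≡true = ⊥-elim (not-¬ f₀≡true f₀)
  sorts {suc p} {suc q} (ℕ.s≤s p≤q)         = π-sorts p≤q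
... | π , π-sorts | true = Perm.insert last zero π , sorts
  where
  last = Fin.fromℕ n
  sorts : Sorts f (Perm.insert last zero π)
  sorts {p} {q} p≤q fp with punchIn-view last q
  ... | inj₁ refl rewrite insert-at last zero π = f₀
  ... | inj₂ (kq , refl) with punchIn-view last p
  ...   | inj₁ refl = ⊥-elim (punchInᵢ≢i last kq (Finₚ.≤-antisym (Finₚ.≤fromℕ _) p≤q))
  ...   | inj₂ (kp , refl) rewrite insert-punchIn last zero π kp | insert-punchIn last zero π kq =
    π-sorts (punchIn-cancel-≤ last kp kq p≤q) fp

module Orderings {n} (G : Graph n) where
  open Notation G
  open Partitions G

  split⇒condD : IsSplit G → ∃ (CondD G)
  split⇒condD split@(inK , clique , _) with (σ , sorts) ← sorting inK =
    σ , λ i j k i<j j<k vi~vj →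
      let vj∈K = later-in-K i<j vi~vj in
      clique _ _ vj∈K (sorts (ℕₚ.<⇒≤ j<k) vj∈K)
        λ vj≡vk → ℕₚ.<⇒≢ j<k (cong toℕ (Injection.injective (↔⇒↣ σ) vj≡vk))
    where
    open SplitGraph G split using (other-end)
    later-in-K : ∀ {i j} → toℕ i < toℕ j → σ ⟨$⟩ʳ i ~ σ ⟨$⟩ʳ j → inK (σ ⟨$⟩ʳ j) ≡ true
    later-in-K {i} i<j vi~vj with inK (σ ⟨$⟩ʳ i) in vi∈K?
    ... | true  = sorts (ℕₚ.<⇒≤ i<j) vi∈K?
    ... | false = other-end vi~vj vi∈K?

  condD⇒condC : ∃ (CondD G) → ∃ (CondC G)
  condD⇒condC (σ , condD) =
      σ
    , (λ i j k i<j j<k vi~vj _ → condD i j k i<j j<k vi~vj)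
    , (λ i j k i<j j<k vi~vj → inj₁ (condD i j k i<j j<k vi~vj))

  condC⇒split : ∃ (CondC G) → IsSplit G
  condC⇒split (σ , transitive , dominating) = splitPartition⇒split (clique , independent)
    where
    pos : Fin n → Fin n
    pos u = σ ⟨$⟩ˡ u

    HasEarlierNeighbour : Fin n → Set
    HasEarlierNeighbour u = ∃ λ q → q Fin.< pos u × σ ⟨$⟩ʳ q ~ u

    has-earlier-neighbour? : ∀ u → Dec (HasEarlierNeighbour u)
    has-earlier-neighbour? u = any? λ q → (q Finₚ.<? pos u) ×-dec dec G (σ ⟨$⟩ʳ q) u

    K : Subset n
    K = toSubset has-earlier-neighbour?

    adjacent-to-later : ∀ {u w} → HasEarlierNeighbour u → pos u Fin.< pos w → u ~ w
    adjacent-to-later (q , q<u , q~u) u<w =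
      ≡.subst₂ _~_ (inverseʳ σ) (inverseʳ σ)
        ([ id , transitive _ _ _ q<u u<w q~u′ ]′ (dominating _ _ _ q<u u<w q~u′))
      where
      q~u′ = ≡.subst (_ ~_) (≡.sym (inverseʳ σ)) q~u

    by-position : {R : Fin n → Fin n → Set} → (∀ {u w} → R u w → R w u) →
                  (∀ {u w} → pos u Fin.< pos w → R u w) → ∀ {u w} → u ≢ w → R u w
    by-position R-sym earlier {u} {w} u≢w with Finₚ.<-cmp (pos u) (pos w)
    ... | tri< u<w _ _ = earlier u<w
    ... | tri≈ _ u≡w _ = ⊥-elim (u≢w (Injection.injective (↔⇒↣ (↔-sym σ)) u≡w))
    ... | tri> _ _ w<u = R-sym (earlier w<u)

    clique : Clique K
    clique u∈K w∈K u≢w =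
      by-position (λ R-uw w∈ u∈ → sym G (R-uw u∈ w∈))
        (λ u<w u∈ _ → adjacent-to-later (∈-toSubset⁻ has-earlier-neighbour? u∈) u<w)
        u≢w u∈K w∈K

    independent : ∀ {u w} → u ∉ K → w ∉ K → ¬ u ~ w
    independent u∉K w∉K u~w =
      by-position (λ R-uw w∉ u∉ w~u → R-uw u∉ w∉ (sym G w~u))
        (λ {u} {w} u<w _ w∉ u~w →
           w∉ (∈-toSubset⁺ has-earlier-neighbour? (pos u , u<w , ≡.subst (_~ w) (≡.sym (inverseʳ σ)) u~w)))
        (~⇒≢ u~w) u∉K w∉K u~w

theorem10 : ∀ {n : ℕ} (G : Graph n) →
    (IsSplit G ⇔ (IsChordal G × IsChordal (complement G)))
    × (IsSplit G ⇔ ∃ (λ σ → CondC G σ))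
    × (IsSplit G ⇔ ∃ (λ σ → CondD G σ))
theorem10 G =
    mk⇔ (λ split → split⇒chordal G split , split⇒chordal (complement G) (split⇒complement-split G split))
        (λ (chordal , cochordal) →
           Partitions.splitPartition⇒split G (proj₂ (chordal⇒splitPartition G chordal cochordal)))
  , mk⇔ (condD⇒condC ∘ split⇒condD) condC⇒split
  , mk⇔ split⇒condD (condC⇒split ∘ condD⇒condC)
  where
  open SplitGraph using (split⇒chordal)
  open Orderings G
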